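{- The structure $(|{\mathcal M}_c|,\preccurlyeq_c,\ell_c)$, where $|{\mathcal M}_c|$ is the set of prime types, $\Phi\preccurlyeq_c\Psi$ iff $\Phi^+\subseteq\Psi^+$, and $\ell_c(\Phi)=\Phi$, is an $\mathcal L_\lozenge$-labelled frame.
   Context: $\mathcal L_\lozenge$ is the language $\bot\mid p\mid\varphi\wedge\psi\mid\varphi\vee\psi\mid\varphi\to\psi\mid\bigcirc\varphi\mid\lozenge\varphi$. ${\sf ITL}^0_\lozenge$ is the least set of $\mathcal L_\lozenge$-formulas containing all intuitionistic propositional tautologies and all instances of $\neg\bigcirc\bot$; $\bigcirc\varphi\wedge\bigcirc\psi\to\bigcirc(\varphi\wedge\psi)$; $\bigcirc(\varphi\vee\psi)\to\bigcirc\varphi\vee\bigcirc\psi$; $\bigcirc(\varphi\to\psi)\to(\bigcirc\varphi\to\bigcirc\psi)$; $\varphi\vee\bigcirc\lozenge\varphi\to\lozenge\varphi$; closed under modus ponens, from $\varphi$ infer $\bigcirc\varphi$, from $\varphi\to\psi$ infer $\lozenge\varphi\to\lozenge\psi$, from $\bigcirc\varphi\to\varphi$ infer $\lozenge\varphi\to\varphi$. $\Gamma\vdash\Delta$ means $\bigwedge\Gamma'\to\bigvee\Delta'\in{\sf ITL}^0_\lozenge$ for some finite $\Gamma'\subseteq\Gamma,\Delta'\subseteq\Delta$. A prime type is a pair $\Phi=(\Phi^-,\Phi^+)$ with $\Phi^-\cup\Phi^+=\mathcal L_\lozenge$ and $\Phi^+\not\vdash\Phi^-$. For $\Sigma$ closed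 under subformulas, a $\Sigma$-type is a pair $(\Phi^-;\Phi^+)$ of subsets of $\Sigma$ with $\Phi^-\cap\Phi^+=\varnothing$, $\Phi^-\cup\Phi^+=\Sigma$, $\bot\notin\Phi^+$; $\varphi\wedge\psi\in\Phi^+$ iff $\varphi,\psi\in\Phi^+$; $\varphi\vee\psi\in\Phi^+$ iff $\varphi\in\Phi^+$ or $\psi\in\Phi^+$; $\varphi\to\psi\in\Phi^+$ implies $\varphi\in\Phi^-$ or $\psi\in\Phi^+$; $\lozenge\varphi\in\Phi^-$ implies $\varphi\in\Phi^-$. A $\Sigma$-labelled frame is $(W,\preccurlyeq,\ell)$ with $\preccurlyeq$ a partial order on $W$ and $\ell$ mapping $W$ into $\Sigma$-types such that $w\preccurlyeq v$ implies $\ell^+(w)\subseteq\ell^+(v)$, and whenever $\varphi\to\psi\in\ell^-(w)$ there is $v\succcurlyeq w$ with $\varphi\in\ell^+(v)$ and $\psi\in\ell^-(v)$. -}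

module Defs where

open import Data.Nat using (ℕ)
open import Data.List using (List; []; _∷_)
open import Data.List.Membership.Propositional using () renaming (_∈_ to _∈ₗ_)
open import Data.Product using (Σ; _×_; _,_; ∃; proj₁; proj₂)
open import Data.Sum using (_⊎_)
open import Data.Empty using (⊥)
open import Relation.Nullary using (¬_)
open import Relation.Unary using (Pred; _∈_; _∉_; _⊆_; _≐_; U)
open import Relation.Binary using (Rel; IsPartialOrder)
open import Level using (Level; _⊔_) renaming (zero to lzero)

infixr 5 _⇒_
infixr 6 _∨_
infixr 7 _∧_

data Fm : Set where
  fls  : Fm
  var  : ℕ → Fm
  _∧_  : Fm → Fm → Fm
  _∨_  : Fm → Fm → Fm
  _⇒_  : Fm → Fm → Fm
  ○    : Fm → Fm
  ◇    : Fm → Fm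

¬' : Fm → Fm
¬' φ = φ ⇒ fls

tru : Fm
tru = fls ⇒ fls

-- The logic ITL⁰◇.  Intuitionistic propositional tautologies (all
-- L◇-instances) are generated by a standard Hilbert axiomatisation of IPC
-- together with modus ponens.
data ITL : Fm → Set where
  ax-K    : ∀ φ ψ → ITL (φ ⇒ ψ ⇒ φ)
  ax-S    : ∀ φ ψ χ → ITL ((φ ⇒ ψ ⇒ χ) ⇒ (φ ⇒ ψ) ⇒ φ ⇒ χ)
  ax-∧I   : ∀ φ ψ → ITL (φ ⇒ ψ ⇒ φ ∧ ψ)
  ax-∧E₁  : ∀ φ ψ → ITL (φ ∧ ψ ⇒ φ)
  ax-∧E₂  : ∀ φ ψ → ITL (φ ∧ ψ ⇒ ψ)
  ax-∨I₁  : ∀ φ ψ → ITL (φ ⇒ φ ∨ ψ)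
  ax-∨I₂  : ∀ φ ψ → ITL (ψ ⇒ φ ∨ ψ)
  ax-∨E   : ∀ φ ψ χ → ITL ((φ ⇒ χ) ⇒ (ψ ⇒ χ) ⇒ φ ∨ ψ ⇒ χ)
  ax-⊥E   : ∀ φ → ITL (fls ⇒ φ)
  ax-○⊥   : ITL (¬' (○ fls))
  ax-○∧   : ∀ φ ψ → ITL (○ φ ∧ ○ ψ ⇒ ○ (φ ∧ ψ))
  ax-○∨   : ∀ φ ψ → ITL (○ (φ ∨ ψ) ⇒ ○ φ ∨ ○ ψ)
  ax-○⇒   : ∀ φ ψ → ITL (○ (φ ⇒ ψ) ⇒ ○ φ ⇒ ○ ψ)
  ax-◇    : ∀ φ → ITL (φ ∨ ○ (◇ φ) ⇒ ◇ φ)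
  mp      : ∀ {φ ψ} → ITL (φ ⇒ ψ) → ITL φ → ITL ψ
  nec     : ∀ {φ} → ITL φ → ITL (○ φ)
  mon◇    : ∀ {φ ψ} → ITL (φ ⇒ ψ) → ITL (◇ φ ⇒ ◇ ψ)
  ind◇    : ∀ {φ} → ITL (○ φ ⇒ φ) → ITL (◇ φ ⇒ φ)

⋀ : List Fm → Fm
⋀ []       = tru
⋀ (φ ∷ Γ)  = φ ∧ ⋀ Γ

⋁ : List Fm → Fm
⋁ []       = fls
⋁ (φ ∷ Δ)  = φ ∨ ⋁ Δ

FmSet : Set₁
FmSet = Pred Fm lzero

_⊢_ : FmSet → FmSet → Set
Γ ⊢ Δ = Σ (List Fm) λ Γ' → Σ (List Fm) λ Δ' →
          (∀ φ → φ ∈ₗ Γ' → φ ∈ Γ) × (∀ φ → φ ∈ₗ Δ' → φ ∈ Δ) × ITL (⋀ Γ' ⇒ ⋁ Δ')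

-- pairs (Φ⁻ , Φ⁺)
Pair : Set₁
Pair = FmSet × FmSet

record IsPrimeType (Φ : Pair) : Set where
  field
    cover      : ∀ φ → φ ∈ proj₁ Φ ⊎ φ ∈ proj₂ Φ
    consistent : ¬ (proj₂ Φ ⊢ proj₁ Φ)

PrimeType : Set₁
PrimeType = Σ Pair IsPrimeType

-- Σ-types (S plays the role of Σ)
record IsΣType (S : FmSet) (Φ⁻ Φ⁺ : FmSet) : Set where
  field
    ⁻⊆S      : Φ⁻ ⊆ S
    ⁺⊆S      : Φ⁺ ⊆ S
    disjoint : ∀ φ → φ ∈ Φ⁻ → φ ∈ Φ⁺ → ⊥
    cover    : ∀ φ → φ ∈ S → φ ∈ Φ⁻ ⊎ φ ∈ Φ⁺
    bot      : fls ∉ Φ⁺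
    ∧⁺       : ∀ φ ψ → (φ ∧ ψ) ∈ S →
                 ((φ ∧ ψ) ∈ Φ⁺ → φ ∈ Φ⁺ × ψ ∈ Φ⁺) × (φ ∈ Φ⁺ × ψ ∈ Φ⁺ → (φ ∧ ψ) ∈ Φ⁺)
    ∨⁺       : ∀ φ ψ → (φ ∨ ψ) ∈ S →
                 ((φ ∨ ψ) ∈ Φ⁺ → φ ∈ Φ⁺ ⊎ ψ ∈ Φ⁺) × (φ ∈ Φ⁺ ⊎ ψ ∈ Φ⁺ → (φ ∨ ψ) ∈ Φ⁺)
    ⇒⁺       : ∀ φ ψ → (φ ⇒ ψ) ∈ Φ⁺ → φ ∈ Φ⁻ ⊎ ψ ∈ Φ⁺
    ◇⁻       : ∀ φ → ◇ φ ∈ Φ⁻ → φ ∈ Φ⁻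

record IsLabelledFrame {a ℓ₁ ℓ₂ : Level} (S : FmSet) (W : Set a)
         (_≈_ : Rel W ℓ₁) (_≼_ : Rel W ℓ₂) (ℓ : W → Pair) : Set (a ⊔ ℓ₁ ⊔ ℓ₂) where
  field
    partialOrder : IsPartialOrder _≈_ _≼_
    labels       : ∀ w → IsΣType S (proj₁ (ℓ w)) (proj₂ (ℓ w))
    mono         : ∀ {w v} → w ≼ v → proj₂ (ℓ w) ⊆ proj₂ (ℓ v)
    witness      : ∀ w φ ψ → (φ ⇒ ψ) ∈ proj₁ (ℓ w) →
                     ∃ λ v → (w ≼ v) × (φ ∈ proj₂ (ℓ v)) × (ψ ∈ proj₁ (ℓ v))

_≈c_ : Rel PrimeType lzero
Φ ≈c Ψ = (proj₁ (proj₁ Φ) ≐ proj₁ (proj₁ Ψ)) × (proj₂ (proj₁ Φ) ≐ proj₂ (proj₁ Ψ))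

_≼c_ : Rel PrimeType lzero
Φ ≼c Ψ = proj₂ (proj₁ Φ) ⊆ proj₂ (proj₁ Ψ)

ℓc : PrimeType → Pair
ℓc = proj₁

-- Deductive closure under the Hilbert rules makes the label of a prime type an
-- L◇-type, and since Φ⁻ is the complement of Φ⁺, inclusion of positive parts is
-- antisymmetric.  For the witness condition, if φ ⇒ ψ ∈ Φ⁻ then by the deduction
-- theorem (｛ψ｝, Φ⁺ ∪ ｛φ｝) is consistent, and the Lindenbaum lemma extends it to a
-- prime type: with excluded middle, decide the formulas of L◇ one at a time along an
-- enumeration, putting each on whichever side keeps the pair consistent (one side
-- always does, by cut); a derivation from the union uses only finitely many formulas,
-- so it already lives at some stage.

module Submission where

open import Defs
open import Axiom.ExcludedMiddle using (ExcludedMiddle)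
open import Level using () renaming (zero to lzero)

open import Data.Nat using (ℕ; zero; suc; _≤_; _⊔_; _≤′_; ≤′-refl; ≤′-step)
open import Data.Nat.Properties using (≤⇒≤′; m≤m⊔n; m≤n⊔m)
open import Data.List using (List; []; _∷_; _++_; map; concatMap; cartesianProductWith)
open import Data.List.Membership.Propositional using () renaming (_∈_ to _∈ₗ_)
open import Data.List.Membership.Propositional.Properties
  using (∈-++⁺ˡ; ∈-++⁺ʳ; ∈-map⁺; ∈-concatMap⁺; ∈-cartesianProductWith⁺)
open import Data.List.Relation.Binary.Subset.Propositional using () renaming (_⊆_ to _⊆ₗ_)
open import Data.List.Relation.Binary.Subset.Propositional.Properties
  using (xs⊆xs++ys; xs⊆ys++xs; ∷⁺ʳ) renaming (⊆-trans to ⊆ₗ-trans)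
open import Data.List.Relation.Unary.All as All using (All; []; _∷_)
open import Data.List.Relation.Unary.All.Properties using (++⁺)
open import Data.List.Relation.Unary.Any as Any using (here; there)
open import Data.Product using (Σ; ∃; ∃₂; _×_; _,_; proj₁; proj₂; zip′)
import Data.Product as Product
open import Data.Sum using (_⊎_; inj₁; inj₂)
open import Data.Empty using (⊥; ⊥-elim)
open import Function using (id)
open import Relation.Nullary using (¬_; yes; no)
open import Relation.Unary using (U; Pred; _∈_; _⊆_; _∪_; ｛_｝; ⋃)
open import Relation.Unary.Properties using (≐-refl; ≐-sym; ≐-trans)
open import Relation.Binary using (IsPartialOrder)
open import Relation.Binary.PropositionalEquality using (refl; sym)

infix 4 _⊢ᴴ_ _⊢ˢ_

variable
  Γ Γ′ Δ Δ′ : List Fm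
  φ ψ χ : Fm
  X Y Y′ : FmSet

data _⊢ᴴ_ (Γ : List Fm) : Fm → Set where
  hyp : φ ∈ₗ Γ → Γ ⊢ᴴ φ
  thm : ITL φ → Γ ⊢ᴴ φ
  app : Γ ⊢ᴴ φ ⇒ ψ → Γ ⊢ᴴ φ → Γ ⊢ᴴ ψ

ITL-id : ∀ φ → ITL (φ ⇒ φ)
ITL-id φ = mp (mp (ax-S φ (φ ⇒ φ) φ) (ax-K φ (φ ⇒ φ))) (ax-K φ φ)

h₀ : φ ∷ Γ ⊢ᴴ φ
h₀ = hyp (here refl)

h₁ : ψ ∷ φ ∷ Γ ⊢ᴴ φ
h₁ = hyp (there (here refl))

deduction : φ ∷ Γ ⊢ᴴ ψ → Γ ⊢ᴴ φ ⇒ ψ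
deduction (hyp (here refl)) = thm (ITL-id _)
deduction (hyp (there ψ∈)) = app (thm (ax-K _ _)) (hyp ψ∈)
deduction (thm t)          = app (thm (ax-K _ _)) (thm t)
deduction (app d e)        = app (app (thm (ax-S _ _ _)) (deduction d)) (deduction e)

⊢ᴴ-subst : (∀ {x} → x ∈ₗ Γ → Δ ⊢ᴴ x) → Γ ⊢ᴴ φ → Δ ⊢ᴴ φ
⊢ᴴ-subst σ (hyp φ∈)  = σ φ∈
⊢ᴴ-subst σ (thm t)   = thm t
⊢ᴴ-subst σ (app d e) = app (⊢ᴴ-subst σ d) (⊢ᴴ-subst σ e)

⊢ᴴ-weaken : Γ ⊆ₗ Δ → Γ ⊢ᴴ φ → Δ ⊢ᴴ φ
⊢ᴴ-weaken Γ⊆Δ = ⊢ᴴ-subst (λ x∈ → hyp (Γ⊆Δ x∈))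

[]⊢ᴴ⇒ITL : [] ⊢ᴴ φ → ITL φ
[]⊢ᴴ⇒ITL (thm t)   = t
[]⊢ᴴ⇒ITL (app d e) = mp ([]⊢ᴴ⇒ITL d) ([]⊢ᴴ⇒ITL e)

∧-intro : Γ ⊢ᴴ φ → Γ ⊢ᴴ ψ → Γ ⊢ᴴ φ ∧ ψ
∧-intro d e = app (app (thm (ax-∧I _ _)) d) e

∧-elimˡ : Γ ⊢ᴴ φ ∧ ψ → Γ ⊢ᴴ φ
∧-elimˡ = app (thm (ax-∧E₁ _ _))

∧-elimʳ : Γ ⊢ᴴ φ ∧ ψ → Γ ⊢ᴴ ψ
∧-elimʳ = app (thm (ax-∧E₂ _ _))

∨-introˡ : Γ ⊢ᴴ φ → Γ ⊢ᴴ φ ∨ ψ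
∨-introˡ = app (thm (ax-∨I₁ _ _))

∨-introʳ : Γ ⊢ᴴ ψ → Γ ⊢ᴴ φ ∨ ψ
∨-introʳ = app (thm (ax-∨I₂ _ _))

∨-elim : Γ ⊢ᴴ φ ∨ ψ → φ ∷ Γ ⊢ᴴ χ → ψ ∷ Γ ⊢ᴴ χ → Γ ⊢ᴴ χ
∨-elim d e f = app (app (app (thm (ax-∨E _ _ _)) (deduction e)) (deduction f)) d

fls-elim : Γ ⊢ᴴ fls → Γ ⊢ᴴ φ
fls-elim = app (thm (ax-⊥E _))

⋀-intro : (∀ {x} → x ∈ₗ Δ → Γ ⊢ᴴ x) → Γ ⊢ᴴ ⋀ Δ
⋀-intro {[]}    _ = thm (ITL-id fls)
⋀-intro {_ ∷ _} f = ∧-intro (f (here refl)) (⋀-intro (λ x∈ → f (there x∈)))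

⋀-elim : Γ ⊢ᴴ ⋀ Δ → φ ∈ₗ Δ → Γ ⊢ᴴ φ
⋀-elim d (here refl) = ∧-elimˡ d
⋀-elim d (there φ∈)  = ⋀-elim (∧-elimʳ d) φ∈

⋁-intro : φ ∈ₗ Δ → Γ ⊢ᴴ φ → Γ ⊢ᴴ ⋁ Δ
⋁-intro (here refl) d = ∨-introˡ d
⋁-intro (there φ∈)  d = ∨-introʳ (⋁-intro φ∈ d)

⋁-elim : (∀ {x} → x ∈ₗ Δ → Γ ⊢ᴴ x ⇒ φ) → Γ ⊢ᴴ ⋁ Δ ⇒ φ
⋁-elim {[]}    _ = thm (ax-⊥E _)
⋁-elim {_ ∷ _} f = app (app (thm (ax-∨E _ _ _)) (f (here refl))) (⋁-elim (λ x∈ → f (there x∈)))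

_⊢ˢ_ : List Fm → List Fm → Set
Γ ⊢ˢ Δ = Γ ⊢ᴴ ⋁ Δ

⊢ˢ⇒ITL : Γ ⊢ˢ Δ → ITL (⋀ Γ ⇒ ⋁ Δ)
⊢ˢ⇒ITL d = []⊢ᴴ⇒ITL (deduction (⊢ᴴ-subst (⋀-elim h₀) d))

ITL⇒⊢ˢ : ITL (⋀ Γ ⇒ ⋁ Δ) → Γ ⊢ˢ Δ
ITL⇒⊢ˢ t = app (thm t) (⋀-intro hyp)

⊢ˢ-weaken : Γ ⊆ₗ Γ′ → Δ ⊆ₗ Δ′ → Γ ⊢ˢ Δ → Γ′ ⊢ˢ Δ′
⊢ˢ-weaken Γ⊆ Δ⊆ d = app (⋁-elim (λ x∈ → deduction (⋁-intro (Δ⊆ x∈) h₀))) (⊢ᴴ-weaken Γ⊆ d)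

⊢ˢ-cut : Γ ⊢ˢ φ ∷ Δ → φ ∷ Γ ⊢ˢ Δ → Γ ⊢ˢ Δ
⊢ˢ-cut d e = ∨-elim d e h₀

⊢ˢ-⇒ : φ ∷ Γ ⊢ˢ ψ ∷ [] → Γ ⊢ˢ (φ ⇒ ψ) ∷ []
⊢ˢ-⇒ d = ∨-introˡ (deduction (∨-elim d h₀ (fls-elim h₀)))

⊢-intro : All (_∈ X) Γ → All (_∈ Y) Δ → Γ ⊢ˢ Δ → X ⊢ Y
⊢-intro {Γ = Γ} {Δ = Δ} Γ∈ Δ∈ d =
  Γ , Δ , (λ _ → All.lookup Γ∈) , (λ _ → All.lookup Δ∈) , ⊢ˢ⇒ITL d

⊢-elim : X ⊢ Y → ∃₂ λ Γ Δ → All (_∈ X) Γ × All (_∈ Y) Δ × Γ ⊢ˢ Δ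
⊢-elim (Γ , Δ , Γ∈ , Δ∈ , t) =
  Γ , Δ , All.tabulate (Γ∈ _) , All.tabulate (Δ∈ _) , ITL⇒⊢ˢ t

⊢-monoʳ : Y ⊆ Y′ → X ⊢ Y → X ⊢ Y′
⊢-monoʳ Y⊆Y′ (Γ , Δ , Γ∈ , Δ∈ , t) = Γ , Δ , Γ∈ , (λ φ φ∈ → Y⊆Y′ (Δ∈ φ φ∈)) , t

split-∪｛｝ : All (_∈ X ∪ ｛ χ ｝) Γ → ∃ λ Γ′ → All (_∈ X) Γ′ × Γ ⊆ₗ χ ∷ Γ′
split-∪｛｝ [] = [] , [] , λ ()
split-∪｛｝ {χ = χ} (inj₁ x∈X ∷ Γ∈) with split-∪｛｝ Γ∈
... | Γ′ , Γ′∈ , Γ⊆ = _ ∷ Γ′ , x∈X ∷ Γ′∈ , λ where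
  (here refl) → there (here refl)
  (there y∈)  → ∷⁺ʳ χ there (Γ⊆ y∈)
split-∪｛｝ (inj₂ refl ∷ Γ∈) with split-∪｛｝ Γ∈
... | Γ′ , Γ′∈ , Γ⊆ = Γ′ , Γ′∈ , λ where
  (here refl) → here refl
  (there y∈)  → Γ⊆ y∈

⊢-cut : (X ∪ ｛ χ ｝) ⊢ Y → X ⊢ (Y ∪ ｛ χ ｝) → X ⊢ Y
⊢-cut {χ = χ} d₁ d₂ with ⊢-elim d₁ | ⊢-elim d₂
... | Γ₁ , Δ₁ , Γ₁∈ , Δ₁∈ , s₁ | Γ₂ , Δ₂ , Γ₂∈ , Δ₂∈ , s₂
  with split-∪｛｝ Γ₁∈ | split-∪｛｝ Δ₂∈
... | Γ₁′ , Γ₁′∈ , Γ₁⊆ | Δ₂′ , Δ₂′∈ , Δ₂⊆ =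
  ⊢-intro (++⁺ Γ₂∈ Γ₁′∈) (++⁺ Δ₂′∈ Δ₁∈) (⊢ˢ-cut
    (⊢ˢ-weaken (xs⊆xs++ys Γ₂ Γ₁′) (⊆ₗ-trans Δ₂⊆ (∷⁺ʳ χ (xs⊆xs++ys Δ₂′ Δ₁))) s₂)
    (⊢ˢ-weaken (⊆ₗ-trans Γ₁⊆ (∷⁺ʳ χ (xs⊆ys++xs Γ₁′ Γ₂))) (xs⊆ys++xs Δ₁ Δ₂′) s₁))

⊢-deduction : (X ∪ ｛ φ ｝) ⊢ ｛ ψ ｝ → X ⊢ ｛ φ ⇒ ψ ｝
⊢-deduction {ψ = ψ} d with ⊢-elim d
... | Γ , Δ , Γ∈ , Δ∈ , s with split-∪｛｝ Γ∈
... | Γ′ , Γ′∈ , Γ⊆ = ⊢-intro Γ′∈ (refl ∷ []) (⊢ˢ-⇒ (⊢ˢ-weaken Γ⊆ Δ⊆ψ s))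
  where
  Δ⊆ψ : Δ ⊆ₗ ψ ∷ []
  Δ⊆ψ x∈ = here (sym (All.lookup Δ∈ x∈))

module PrimeTypeProperties (Φ : PrimeType) where
  open IsPrimeType (proj₂ Φ)

  Φ⁻ Φ⁺ : FmSet
  Φ⁻ = proj₁ (proj₁ Φ)
  Φ⁺ = proj₂ (proj₁ Φ)

  refute : All (_∈ Φ⁺) Γ → All (_∈ Φ⁻) Δ → ¬ Γ ⊢ˢ Δ
  refute Γ∈ Δ∈ d = consistent (⊢-intro Γ∈ Δ∈ d)

  disjoint : φ ∈ Φ⁻ → φ ∈ Φ⁺ → ⊥
  disjoint φ∈Φ⁻ φ∈Φ⁺ = refute (φ∈Φ⁺ ∷ []) (φ∈Φ⁻ ∷ []) (∨-introˡ h₀)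

  ⁺-closed : All (_∈ Φ⁺) Γ → Γ ⊢ᴴ φ → φ ∈ Φ⁺
  ⁺-closed {φ = φ} Γ∈ d with cover φ
  ... | inj₁ φ∈Φ⁻ = ⊥-elim (refute Γ∈ (φ∈Φ⁻ ∷ []) (∨-introˡ d))
  ... | inj₂ φ∈Φ⁺ = φ∈Φ⁺

  ∨-prime : φ ∨ ψ ∈ Φ⁺ → φ ∈ Φ⁺ ⊎ ψ ∈ Φ⁺
  ∨-prime {φ} {ψ} p with cover φ | cover ψ
  ... | inj₂ φ∈Φ⁺ | _         = inj₁ φ∈Φ⁺
  ... | inj₁ _    | inj₂ ψ∈Φ⁺ = inj₂ ψ∈Φ⁺
  ... | inj₁ φ∈Φ⁻ | inj₁ ψ∈Φ⁻ = ⊥-elim (refute (p ∷ []) (φ∈Φ⁻ ∷ ψ∈Φ⁻ ∷ [])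
                                   (∨-elim h₀ (∨-introˡ h₀) (∨-introʳ (∨-introˡ h₀))))

  ⇒-prime : φ ⇒ ψ ∈ Φ⁺ → φ ∈ Φ⁻ ⊎ ψ ∈ Φ⁺
  ⇒-prime {φ} p with cover φ
  ... | inj₁ φ∈Φ⁻ = inj₁ φ∈Φ⁻
  ... | inj₂ φ∈Φ⁺ = inj₂ (⁺-closed (p ∷ φ∈Φ⁺ ∷ []) (app h₀ h₁))

  ◇-⁻ : ◇ φ ∈ Φ⁻ → φ ∈ Φ⁻
  ◇-⁻ {φ} ◇φ∈Φ⁻ with cover φ
  ... | inj₁ φ∈Φ⁻ = φ∈Φ⁻
  ... | inj₂ φ∈Φ⁺ = ⊥-elim (disjoint ◇φ∈Φ⁻ (⁺-closed (φ∈Φ⁺ ∷ []) (app (thm (ax-◇ φ)) (∨-introˡ h₀))))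

  isΣType : IsΣType U Φ⁻ Φ⁺
  isΣType = record
    { ⁻⊆S      = λ _ → _
    ; ⁺⊆S      = λ _ → _
    ; disjoint = λ _ → disjoint
    ; cover    = λ φ _ → cover φ
    ; bot      = λ fls∈Φ⁺ → refute (fls∈Φ⁺ ∷ []) [] h₀
    ; ∧⁺       = λ _ _ _ →
        (λ p → ⁺-closed (p ∷ []) (∧-elimˡ h₀) , ⁺-closed (p ∷ []) (∧-elimʳ h₀)) ,
        (λ (p , q) → ⁺-closed (p ∷ q ∷ []) (∧-intro h₀ h₁))
    ; ∨⁺       = λ _ _ _ → ∨-prime , λ where
        (inj₁ p) → ⁺-closed (p ∷ []) (∨-introˡ h₀)
        (inj₂ q) → ⁺-closed (q ∷ []) (∨-introʳ h₀)
    ; ⇒⁺       = λ _ _ → ⇒-prime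
    ; ◇⁻       = λ _ → ◇-⁻
    }

⁻-antitone : (Φ Ψ : PrimeType) → Φ ≼c Ψ → proj₁ (proj₁ Ψ) ⊆ proj₁ (proj₁ Φ)
⁻-antitone Φ Ψ Φ≼Ψ {φ} φ∈Ψ⁻ with IsPrimeType.cover (proj₂ Φ) φ
... | inj₁ φ∈Φ⁻ = φ∈Φ⁻
... | inj₂ φ∈Φ⁺ = ⊥-elim (PrimeTypeProperties.disjoint Ψ φ∈Ψ⁻ (Φ≼Ψ φ∈Φ⁺))

≼c-isPartialOrder : IsPartialOrder _≈c_ _≼c_
≼c-isPartialOrder = record
  { isPreorder = record
    { isEquivalence = record
      { refl  = ≐-refl , ≐-refl
      ; sym   = Product.map ≐-sym ≐-sym
      ; trans = zip′ ≐-trans ≐-trans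
      }
    ; reflexive = λ (_ , Φ⁺≐Ψ⁺) → proj₁ Φ⁺≐Ψ⁺
    ; trans     = λ Φ≼Ψ Ψ≼Θ φ∈ → Ψ≼Θ (Φ≼Ψ φ∈)
    }
  ; antisym = λ {Φ} {Ψ} Φ≼Ψ Ψ≼Φ →
      (⁻-antitone Ψ Φ Ψ≼Φ , ⁻-antitone Φ Ψ Φ≼Ψ) , (Φ≼Ψ , Ψ≼Φ)
  }

module Chain {A : Set} (S : ℕ → Pred A lzero) (S-step : ∀ n → S n ⊆ S (suc n)) where

  mono : ∀ {m n} → m ≤ n → S m ⊆ S n
  mono m≤n = mono′ (≤⇒≤′ m≤n)
    where
    mono′ : ∀ {m n} → m ≤′ n → S m ⊆ S n
    mono′ ≤′-refl        x∈ = x∈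
    mono′ (≤′-step m≤′n) x∈ = S-step _ (mono′ m≤′n x∈)

  bound : ∀ {xs} → All (_∈ ⋃ ℕ S) xs → ∃ λ N → All (_∈ S N) xs
  bound [] = 0 , []
  bound ((m , x∈) ∷ xs∈) with bound xs∈
  ... | n , xs∈ₙ = m ⊔ n , mono (m≤m⊔n m n) x∈ ∷ All.map (mono (m≤n⊔m m n)) xs∈ₙ

unaries : List (Fm → Fm)
unaries = ○ ∷ ◇ ∷ []

binaries : List (Fm → Fm → Fm)
binaries = _∧_ ∷ _∨_ ∷ _⇒_ ∷ []

grow : ℕ → List Fm → List Fm
grow n xs = fls ∷ var n ∷ concatMap (λ f → map f xs) unaries
                       ++ concatMap (λ f → cartesianProductWith f xs xs) binaries

formulas : ℕ → List Fm
formulas zero    = []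
formulas (suc n) = formulas n ++ grow n (formulas n)

module Formulas = Chain (λ n φ → φ ∈ₗ formulas n) (λ n → xs⊆xs++ys (formulas n) _)

Enumerated : FmSet
Enumerated = ⋃ ℕ (λ n φ → φ ∈ₗ formulas n)

∈-grow-unary : ∀ {f xs} n → f ∈ₗ unaries → φ ∈ₗ xs → f φ ∈ₗ grow n xs
∈-grow-unary {xs = xs} n f∈ φ∈ = there (there (∈-++⁺ˡ
  (∈-concatMap⁺ (λ g → map g xs) (Any.map (λ { refl → ∈-map⁺ _ φ∈ }) f∈))))

∈-grow-binary : ∀ {f xs} n → f ∈ₗ binaries → φ ∈ₗ xs → ψ ∈ₗ xs → f φ ψ ∈ₗ grow n xs
∈-grow-binary {xs = xs} n f∈ φ∈ ψ∈ = there (there (∈-++⁺ʳ (concatMap (λ g → map g xs) unaries)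
  (∈-concatMap⁺ (λ g → cartesianProductWith g xs xs)
    (Any.map (λ { refl → ∈-cartesianProductWith⁺ _ φ∈ ψ∈ }) f∈))))

grown-enumerated : ∀ n → φ ∈ₗ grow n (formulas n) → φ ∈ Enumerated
grown-enumerated n φ∈ = suc n , ∈-++⁺ʳ (formulas n) φ∈

unary-enumerated : ∀ {f} → f ∈ₗ unaries → φ ∈ Enumerated → f φ ∈ Enumerated
unary-enumerated f∈ (n , φ∈) = grown-enumerated n (∈-grow-unary n f∈ φ∈)

binary-enumerated : ∀ {f} → f ∈ₗ binaries → φ ∈ Enumerated → ψ ∈ Enumerated → f φ ψ ∈ Enumerated
binary-enumerated f∈ φ∈ ψ∈ with Formulas.bound (φ∈ ∷ ψ∈ ∷ [])
... | n , φ∈ₙ ∷ ψ∈ₙ ∷ [] = grown-enumerated n (∈-grow-binary n f∈ φ∈ₙ ψ∈ₙ)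

all-enumerated : ∀ φ → φ ∈ Enumerated
all-enumerated fls     = grown-enumerated 0 (here refl)
all-enumerated (var k) = grown-enumerated k (there (here refl))
all-enumerated (φ ∧ ψ) = binary-enumerated (here refl) (all-enumerated φ) (all-enumerated ψ)
all-enumerated (φ ∨ ψ) = binary-enumerated (there (here refl)) (all-enumerated φ) (all-enumerated ψ)
all-enumerated (φ ⇒ ψ) = binary-enumerated (there (there (here refl))) (all-enumerated φ) (all-enumerated ψ)
all-enumerated (○ φ)   = unary-enumerated (here refl) (all-enumerated φ)
all-enumerated (◇ φ)   = unary-enumerated (there (here refl)) (all-enumerated φ)

_⊑_ : Pair → Pair → Set
(Δ , Γ) ⊑ (Δ′ , Γ′) = Δ ⊆ Δ′ × Γ ⊆ Γ′

⊑-refl : ∀ {p} → p ⊑ p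
⊑-refl = id , id

⊑-trans : ∀ {p q r} → p ⊑ q → q ⊑ r → p ⊑ r
⊑-trans (Δ⊆ , Γ⊆) (Δ′⊆ , Γ′⊆) = (λ φ∈ → Δ′⊆ (Δ⊆ φ∈)) , (λ φ∈ → Γ′⊆ (Γ⊆ φ∈))

Consistent : Pair → Set
Consistent (Δ , Γ) = ¬ (Γ ⊢ Δ)

ConsistentPair : Set₁
ConsistentPair = Σ Pair Consistent

⇒∈⁻-consistent : (Φ : PrimeType) → φ ⇒ ψ ∈ proj₁ (proj₁ Φ) →
                 Consistent (｛ ψ ｝ , proj₂ (proj₁ Φ) ∪ ｛ φ ｝)
⇒∈⁻-consistent (_ , Φ-prime) φ⇒ψ∈Φ⁻ d =
  IsPrimeType.consistent Φ-prime (⊢-monoʳ (λ { refl → φ⇒ψ∈Φ⁻ }) (⊢-deduction d))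

Decides : Pair → Fm → Set
Decides (Δ , Γ) φ = φ ∈ Δ ⊎ φ ∈ Γ

Decides-mono : ∀ {p q} → p ⊑ q → Decides p φ → Decides q φ
Decides-mono (Δ⊆ , _) (inj₁ φ∈Δ) = inj₁ (Δ⊆ φ∈Δ)
Decides-mono (_ , Γ⊆) (inj₂ φ∈Γ) = inj₂ (Γ⊆ φ∈Γ)

module Lindenbaum (em : ExcludedMiddle lzero) where

  Extension : ConsistentPair → (Pair → Set) → Set₁
  Extension (p , _) P = Σ ConsistentPair λ (q , _) → p ⊑ q × P q

  decide : ∀ p φ → Extension p (λ q → Decides q φ)
  decide ((Δ , Γ) , Γ⊬Δ) φ with em {(Γ ∪ ｛ φ ｝) ⊢ Δ}
  ... | yes Γφ⊢Δ = ((Δ ∪ ｛ φ ｝ , Γ) , λ Γ⊢Δφ → Γ⊬Δ (⊢-cut Γφ⊢Δ Γ⊢Δφ)) , (inj₁ , id) , inj₁ (inj₂ refl)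
  ... | no Γφ⊬Δ  = ((Δ , Γ ∪ ｛ φ ｝) , Γφ⊬Δ) , (id , inj₁) , inj₂ (inj₂ refl)

  decideAll : ∀ p xs → Extension p (λ q → All (Decides q) xs)
  decideAll p [] = p , ⊑-refl , []
  decideAll p (φ ∷ xs) with decide p φ
  ... | q , p⊑q , q-decides with decideAll q xs
  ... | r , q⊑r , r-decides = r , ⊑-trans p⊑q q⊑r , Decides-mono q⊑r q-decides ∷ r-decides

  module Limit (p₀ : ConsistentPair) where

    stage : ℕ → ConsistentPair
    stage zero    = p₀
    stage (suc n) = proj₁ (decideAll (stage n) (formulas n))

    stage-⊑ : ∀ n → proj₁ (stage n) ⊑ proj₁ (stage (suc n))
    stage-⊑ n = proj₁ (proj₂ (decideAll (stage n) (formulas n)))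

    stage-decides : ∀ n → All (Decides (proj₁ (stage (suc n)))) (formulas n)
    stage-decides n = proj₂ (proj₂ (decideAll (stage n) (formulas n)))

    module Neg = Chain (λ n → proj₁ (proj₁ (stage n))) (λ n → proj₁ (stage-⊑ n))
    module Pos = Chain (λ n → proj₂ (proj₁ (stage n))) (λ n → proj₂ (stage-⊑ n))

    limit : Pair
    limit = ⋃ ℕ (λ n → proj₁ (proj₁ (stage n))) , ⋃ ℕ (λ n → proj₂ (proj₁ (stage n)))

    limit-consistent : Consistent limit
    limit-consistent d with ⊢-elim d
    ... | Γ , Δ , Γ∈ , Δ∈ , s with Pos.bound Γ∈ | Neg.bound Δ∈
    ... | m , Γ∈ₘ | n , Δ∈ₙ = proj₂ (stage (m ⊔ n))
      (⊢-intro (All.map (Pos.mono (m≤m⊔n m n)) Γ∈ₘ) (All.map (Neg.mono (m≤n⊔m m n)) Δ∈ₙ) s)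

    limit-decides : ∀ φ → Decides limit φ
    limit-decides φ with all-enumerated φ
    ... | n , φ∈ with All.lookup (stage-decides n) φ∈
    ... | inj₁ φ∈Δ = inj₁ (suc n , φ∈Δ)
    ... | inj₂ φ∈Γ = inj₂ (suc n , φ∈Γ)

    limit-prime : IsPrimeType limit
    limit-prime = record { cover = limit-decides ; consistent = limit-consistent }

  lindenbaum : ∀ p → Consistent p → ∃ λ (Φ : PrimeType) → p ⊑ proj₁ Φ
  lindenbaum p p-consistent = (limit , limit-prime) , (λ φ∈ → 0 , φ∈) , (λ φ∈ → 0 , φ∈)
    where open Limit (p , p-consistent)

  ⇒-witness : ∀ (Φ : PrimeType) φ ψ → φ ⇒ ψ ∈ proj₁ (proj₁ Φ) →
              ∃ λ Ψ → Φ ≼c Ψ × φ ∈ proj₂ (proj₁ Ψ) × ψ ∈ proj₁ (proj₁ Ψ)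
  ⇒-witness Φ φ ψ φ⇒ψ∈Φ⁻ with lindenbaum _ (⇒∈⁻-consistent Φ φ⇒ψ∈Φ⁻)
  ... | Ψ , ψ⊆Ψ⁻ , Φ⁺φ⊆Ψ⁺ = Ψ , (λ χ∈ → Φ⁺φ⊆Ψ⁺ (inj₁ χ∈)) , Φ⁺φ⊆Ψ⁺ (inj₂ refl) , ψ⊆Ψ⁻ refl

lemmaA1 : ExcludedMiddle lzero → IsLabelledFrame U PrimeType _≈c_ _≼c_ ℓc
lemmaA1 em = record
  { partialOrder = ≼c-isPartialOrder
  ; labels       = PrimeTypeProperties.isΣType
  ; mono         = id
  ; witness      = Lindenbaum.⇒-witness em
  }
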